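{- Let $K$ be a field of characteristic zero (e.g. $K=\mathbb{C}$ or $\mathbb{C}_p$), $D=\frac{d}{dt}$, $\Delta=tD$. Let $m\ge 2$ and $N,P_1,\dots,P_m\in K[t]$ with $S=\deg N$, $r_j=\deg P_j$ (degree of the zero polynomial being $-\infty$), and assume $$S\ge 0,\qquad r_m=S+1,\qquad r_j<r_m\quad\text{for all } j=1,\dots,m-1.$$ Then the differential operator $$E(\Delta,t)=N\Delta^m-P_1\Delta^{m-1}-\dots-P_m$$ (corresponding to the equation $N\Delta^mF=P_1\Delta^{m-1}F+\dots+P_m\Delta^0F$) is irreducible in the ring $K(t)[\Delta]$ of differential operators.
   Context: A nonzero operator in the ring of differential operators $K(t)[\Delta]$ (equivalently $K(t)[D]$) is irreducible if it cannot be written as a product of two operators in that ring each of order strictly smaller than its own order. -}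

module Defs where

open import Level using (Level; _⊔_; Lift)
open import Data.Unit using (⊤)
open import Data.Nat using (ℕ; zero; suc; _≤_; _<_)
open import Data.List using (List; []; _∷_; length; map)
open import Data.Product using (Σ; ∃; _×_; _,_)
open import Relation.Nullary using (¬_)
open import Algebra.Bundles using (CommutativeRing)

record Field (c ℓ : Level) : Set (Level.suc (c ⊔ ℓ)) where
  field
    commutativeRing : CommutativeRing c ℓ
  open CommutativeRing commutativeRing public
  field
    1≉0     : ¬ (1# ≈ 0#)
    inverse : ∀ x → ¬ (x ≈ 0#) → Σ Carrier λ y → (x * y) ≈ 1#

module _ {c ℓ : Level} (K : Field c ℓ) where
  open Field K

  natK : ℕ → Carrier
  natK zero    = 0#
  natK (suc n) = 1# + natK n

  CharZero : Set ℓ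
  CharZero = ∀ n → ¬ (natK (suc n) ≈ 0#)

  -- Polynomials K[t]: coefficient lists, lowest degree first.
  Poly : Set c
  Poly = List Carrier

  coeff : Poly → ℕ → Carrier
  coeff []       _       = 0#
  coeff (a ∷ p)  zero    = a
  coeff (a ∷ p)  (suc i) = coeff p i

  -- equality of polynomials (trailing zeros irrelevant)
  _≈P_ : Poly → Poly → Set ℓ
  p ≈P q = ∀ i → coeff p i ≈ coeff q i

  0P 1P : Poly
  0P = []
  1P = 1# ∷ []

  _+P_ : Poly → Poly → Poly
  []      +P q       = q
  (a ∷ p) +P []      = a ∷ p
  (a ∷ p) +P (b ∷ q) = (a + b) ∷ (p +P q)

  -P_ : Poly → Poly
  -P p = map (-_) p

  scaleP : Carrier → Poly → Poly
  scaleP a p = map (a *_) p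

  _*P_ : Poly → Poly → Poly
  []      *P q = []
  (a ∷ p) *P q = scaleP a q +P (0# ∷ (p *P q))

  -- Δ = t·d/dt on polynomials: coefficient of t^i multiplied by i
  ΔP-from : ℕ → Poly → Poly
  ΔP-from i []      = []
  ΔP-from i (a ∷ p) = (natK i * a) ∷ ΔP-from (suc i) p

  ΔP : Poly → Poly
  ΔP = ΔP-from 0

  DegEq : Poly → ℕ → Set ℓ
  DegEq p d = ¬ (coeff p d ≈ 0#) × (∀ i → d < i → coeff p i ≈ 0#)

  -- deg p < d  (true for the zero polynomial)
  DegLt : Poly → ℕ → Set ℓ
  DegLt p d = ∀ i → d ≤ i → coeff p i ≈ 0#

  -- Rational functions K(t): fractions num/den with den ≠ 0,
  -- equality by cross-multiplication.
  record Frac : Set c where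
    constructor _/_
    field
      num den : Poly
  open Frac public

  NonzeroDen : Frac → Set ℓ
  NonzeroDen f = ¬ (den f ≈P 0P)

  _≈F_ : Frac → Frac → Set ℓ
  f ≈F g = (num f *P den g) ≈P (num g *P den f)

  0F : Frac
  0F = 0P / 1P

  ι : Poly → Frac
  ι p = p / 1P

  _+F_ : Frac → Frac → Frac
  (a / b) +F (c' / d) = ((a *P d) +P (c' *P b)) / (b *P d)

  _*F_ : Frac → Frac → Frac
  (a / b) *F (c' / d) = (a *P c') / (b *P d)

  -- the derivation Δ = t d/dt extended to K(t) by the quotient rule
  ΔF : Frac → Frac
  ΔF (a / b) = ((ΔP a *P b) +P (-P (a *P ΔP b))) / (b *P b)

  -- Differential operators K(t)[Δ]: Σ a_i Δ^i, list [a_0, a_1, ...],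
  -- with the commutation rule Δ·f = f·Δ + Δ(f).
  Op : Set c
  Op = List Frac

  WellFormed : Op → Set ℓ
  WellFormed []      = Lift ℓ ⊤
  WellFormed (f ∷ A) = NonzeroDen f × WellFormed A

  coeffOp : Op → ℕ → Frac
  coeffOp []      _       = 0F
  coeffOp (f ∷ A) zero    = f
  coeffOp (f ∷ A) (suc i) = coeffOp A i

  _≈O_ : Op → Op → Set ℓ
  A ≈O B = ∀ i → coeffOp A i ≈F coeffOp B i

  _+O_ : Op → Op → Op
  []      +O B       = B
  (f ∷ A) +O []      = f ∷ A
  (f ∷ A) +O (g ∷ B) = (f +F g) ∷ (A +O B)

  scaleO : Frac → Op → Op
  scaleO f B = map (f *F_) B

  -- left multiplication by Δ:  Δ · Σ b_j Δ^j = Σ (Δ b_j) Δ^j + Σ b_j Δ^{j+1}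
  ΔO : Op → Op
  ΔO B = map ΔF B +O (0F ∷ B)

  -- product in K(t)[Δ]:  (a_0 + A'·Δ)·B = a_0·B + A'·(Δ·B)
  _*O_ : Op → Op → Op
  []      *O B = []
  (a ∷ A) *O B = scaleO a B +O (A *O ΔO B)

  -- irreducibility of a (nonzero) operator E of order m: it is not a
  -- product of two operators of order < m (i.e. with at most m coefficients)
  Irreducible : ℕ → Op → Set (c ⊔ ℓ)
  Irreducible m E =
    ¬ (Σ Op λ A → Σ Op λ B →
         WellFormed A × WellFormed B ×
         length A ≤ m × length B ≤ m × ((A *O B) ≈O E))

  -- E(Δ,t) = N Δ^m - P_1 Δ^{m-1} - ... - P_m,  P : ℕ → Poly indexed 1..m.
  -- Coefficient of Δ^i (i < m) is -P_{m-i}; coefficient of Δ^m is N.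
  opE-from : (m : ℕ) → (P : ℕ → Poly) → (N : Poly) → Op
  opE-from zero    P N = ι N ∷ []
  opE-from (suc j) P N = ι (-P (P (suc j))) ∷ opE-from j P N

  opE : (m : ℕ) → (N : Poly) → (P : ℕ → Poly) → Op
  opE m N P = opE-from m P N

{-# OPTIONS --safe #-}
-- Weigh the term f Δʲ of an operator by m · deg f + j, the degree being taken at t = ∞.
-- Since Δ = t d/dt does not raise degrees, heaviest terms multiply: if A and B each have a
-- unique heaviest term, of weights u and w, then A · B has a unique heaviest term, of weight u + w.
-- In an operator of order < m the weights of the nonzero terms are pairwise distinct modulo m,
-- so each factor of a factorisation of E is either zero or has a unique heaviest term. But in E
-- the terms -P_m and N Δ^m both weigh m (S + 1), while -P_{m-j} Δ^j weighs at most m S + j.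
-- Degrees exist only classically, so the argument runs under a double negation.
module Submission where

open import Defs
open import Level using (Level; _⊔_)
open import Function using (_∘_)
open import Data.Empty using (⊥; ⊥-elim)
open import Data.Product using (Σ; _,_; proj₁; proj₂)
open import Data.Sum using (_⊎_; inj₁; inj₂)
open import Data.List using ([]; _∷_; length; map)
open import Data.Nat using (ℕ; zero; suc; _≤_; _<_; z≤n; s≤s)
import Data.Nat as ℕ
import Data.Nat.Properties as ℕ
import Data.Nat.Divisibility as ℕ
open import Data.Integer using (ℤ; +_; +<+)
import Data.Integer as ℤ
import Data.Integer.Properties as ℤ
open import Data.Integer.Divisibility.Signed using (_∣_; divides; ∣m+n∣n⇒∣m; ∣m∣n⇒∣m-n; ∣⇒∣ᵤ)
open import Data.Integer.Tactic.RingSolver using (solve-∀)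
open import Relation.Nullary using (¬_; yes; no)
open import Relation.Nullary.Decidable.Core using (¬¬-excluded-middle)
open import Relation.Binary using (tri<; tri≈; tri>)
open import Relation.Binary.PropositionalEquality as ≡ using (_≡_; _≢_)
import Relation.Binary.Reasoning.Setoid as SetoidReasoning

k+[i-k]≡i : ∀ k i → k ℤ.+ (i ℤ.- k) ≡ i
k+[i-k]≡i = solve-∀

i<k+j⇒i-k<j : ∀ {i j} k → i ℤ.< k ℤ.+ j → i ℤ.- k ℤ.< j
i<k+j⇒i-k<j {i} {j} k i<k+j = ≡.subst (i ℤ.- k ℤ.<_) ([k+j]-k≡j k j) (ℤ.+-monoˡ-< (ℤ.- k) i<k+j)
  where
    [k+j]-k≡j : ∀ k j → (k ℤ.+ j) ℤ.- k ≡ j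
    [k+j]-k≡j = solve-∀

module Polynomials {c ℓ : Level} (K : Field c ℓ) where
  open Field K
  open import Algebra.Properties.Ring ring using (-0#≈0#; -‿injective)
  open SetoidReasoning setoid

  infix  4 _≈ₚ_
  infixl 6 _+ₚ_
  infixl 7 _*ₚ_

  _≈ₚ_ : Poly K → Poly K → Set ℓ
  _≈ₚ_ = _≈P_ K

  _+ₚ_ _*ₚ_ : Poly K → Poly K → Poly K
  _+ₚ_ = _+P_ K
  _*ₚ_ = _*P_ K

  x*y≉0 : ∀ {x y} → x ≉ 0# → y ≉ 0# → x * y ≉ 0#
  x*y≉0 {x} {y} x≉0 y≉0 xy≈0 with inverse x x≉0
  ... | x⁻¹ , xx⁻¹≈1 = y≉0 (begin
    y             ≈⟨ *-identityˡ y ⟨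
    1# * y        ≈⟨ *-congʳ xx⁻¹≈1 ⟨
    (x * x⁻¹) * y ≈⟨ *-congʳ (*-comm x x⁻¹) ⟩
    (x⁻¹ * x) * y ≈⟨ *-assoc x⁻¹ x y ⟩
    x⁻¹ * (x * y) ≈⟨ *-congˡ xy≈0 ⟩
    x⁻¹ * 0#      ≈⟨ zeroʳ x⁻¹ ⟩
    0#            ∎)

  x≈0∧y≈0⇒x+y≈0 : ∀ {x y} → x ≈ 0# → y ≈ 0# → x + y ≈ 0#
  x≈0∧y≈0⇒x+y≈0 x≈0 y≈0 = trans (+-cong x≈0 y≈0) (+-identityʳ 0#)

  coeff-+P : ∀ p q i → coeff K (p +ₚ q) i ≈ coeff K p i + coeff K q i
  coeff-+P []      q       i       = sym (+-identityˡ _)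
  coeff-+P (a ∷ p) []      zero    = sym (+-identityʳ a)
  coeff-+P (a ∷ p) []      (suc i) = sym (+-identityʳ _)
  coeff-+P (a ∷ p) (b ∷ q) zero    = refl
  coeff-+P (a ∷ p) (b ∷ q) (suc i) = coeff-+P p q i

  coeff-scaleP : ∀ a p i → coeff K (scaleP K a p) i ≈ a * coeff K p i
  coeff-scaleP a []      i       = sym (zeroʳ a)
  coeff-scaleP a (b ∷ p) zero    = refl
  coeff-scaleP a (b ∷ p) (suc i) = coeff-scaleP a p i

  coeff-negP : ∀ p i → coeff K (-P_ K p) i ≈ - coeff K p i
  coeff-negP []      i       = sym -0#≈0#
  coeff-negP (b ∷ p) zero    = refl
  coeff-negP (b ∷ p) (suc i) = coeff-negP p i

  coeff-*P : ∀ a p q i → coeff K ((a ∷ p) *ₚ q) i ≈ a * coeff K q i + coeff K (0# ∷ (p *ₚ q)) i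
  coeff-*P a p q i = trans (coeff-+P (scaleP K a q) (0# ∷ (p *ₚ q)) i) (+-congʳ (coeff-scaleP a q i))

  coeff-ΔP-from : ∀ k p i → coeff K p i ≈ 0# → coeff K (ΔP-from K k p) i ≈ 0#
  coeff-ΔP-from k []      i       _   = refl
  coeff-ΔP-from k (a ∷ p) zero    a≈0 = trans (*-congˡ a≈0) (zeroʳ _)
  coeff-ΔP-from k (a ∷ p) (suc i) h   = coeff-ΔP-from (suc k) p i h

  +P-comm : ∀ p q → p +ₚ q ≈ₚ q +ₚ p
  +P-comm p q i = begin
    coeff K (p +ₚ q) i          ≈⟨ coeff-+P p q i ⟩
    coeff K p i + coeff K q i   ≈⟨ +-comm _ _ ⟩
    coeff K q i + coeff K p i   ≈⟨ coeff-+P q p i ⟨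
    coeff K (q +ₚ p) i          ∎

  *P-zeroˡ : ∀ p q → p ≈ₚ 0P K → p *ₚ q ≈ₚ 0P K
  *P-zeroˡ []      q _   i       = refl
  *P-zeroˡ (a ∷ p) q p≈0 i       = trans (coeff-*P a p q i)
    (x≈0∧y≈0⇒x+y≈0 (trans (*-congʳ (p≈0 0)) (zeroˡ _)) (tail i))
    where
      tail : ∀ i → coeff K (0# ∷ (p *ₚ q)) i ≈ 0#
      tail zero    = refl
      tail (suc i) = *P-zeroˡ p q (λ j → p≈0 (suc j)) i

  coeff-*P-top : ∀ p q α β → (∀ i → α < i → coeff K p i ≈ 0#) → (∀ j → β < j → coeff K q j ≈ 0#) →
                 coeff K (p *ₚ q) (α ℕ.+ β) ≈ coeff K p α * coeff K q β
  coeff-*P-top []      q α       β _  _  = sym (zeroˡ _)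
  coeff-*P-top (a ∷ p) q zero    β hp hq = begin
    coeff K ((a ∷ p) *ₚ q) β                          ≈⟨ coeff-*P a p q β ⟩
    a * coeff K q β + coeff K (0# ∷ (p *ₚ q)) β       ≈⟨ +-congˡ (tail β) ⟩
    a * coeff K q β + 0#                              ≈⟨ +-identityʳ _ ⟩
    a * coeff K q β                                   ∎
    where
      tail : ∀ i → coeff K (0# ∷ (p *ₚ q)) i ≈ 0#
      tail zero    = refl
      tail (suc i) = *P-zeroˡ p q (λ j → hp (suc j) (s≤s z≤n)) i
  coeff-*P-top (a ∷ p) q (suc α) β hp hq = begin
    coeff K ((a ∷ p) *ₚ q) (suc (α ℕ.+ β))                         ≈⟨ coeff-*P a p q _ ⟩
    a * coeff K q (suc (α ℕ.+ β)) + coeff K (p *ₚ q) (α ℕ.+ β)    ≈⟨ +-congʳ (trans (*-congˡ q-vanishes) (zeroʳ a)) ⟩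
    0# + coeff K (p *ₚ q) (α ℕ.+ β)                               ≈⟨ +-identityˡ _ ⟩
    coeff K (p *ₚ q) (α ℕ.+ β)                                    ≈⟨ coeff-*P-top p q α β p-vanishes hq ⟩
    coeff K p α * coeff K q β                                     ∎
    where
      q-vanishes : coeff K q (suc (α ℕ.+ β)) ≈ 0#
      q-vanishes = hq _ (s≤s (ℕ.m≤n+m β α))
      p-vanishes : ∀ i → α < i → coeff K p i ≈ 0#
      p-vanishes i α<i = hp (suc i) (s≤s α<i)

  ScaledDegLe : ℕ → Poly K → ℤ → Set ℓ
  ScaledDegLe m p x = ∀ i → x ℤ.< + (i ℕ.* m) → coeff K p i ≈ 0#

  module _ {m : ℕ} where

    ScaledDegLe-mono : ∀ p {x y} → x ℤ.≤ y → ScaledDegLe m p x → ScaledDegLe m p y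
    ScaledDegLe-mono p x≤y h i y<im = h i (ℤ.≤-<-trans x≤y y<im)

    ScaledDegLe-zero : ∀ p x → p ≈ₚ 0P K → ScaledDegLe m p x
    ScaledDegLe-zero p x p≈0 i _ = p≈0 i

    ScaledDegLe-+P : ∀ p q {x} → ScaledDegLe m p x → ScaledDegLe m q x → ScaledDegLe m (p +ₚ q) x
    ScaledDegLe-+P p q hp hq i lt = trans (coeff-+P p q i) (x≈0∧y≈0⇒x+y≈0 (hp i lt) (hq i lt))

    ScaledDegLe-negP : ∀ p {x} → ScaledDegLe m p x → ScaledDegLe m (-P_ K p) x
    ScaledDegLe-negP p hp i lt = trans (coeff-negP p i) (trans (-‿cong (hp i lt)) -0#≈0#)

    ScaledDegLe-ΔP : ∀ p {x} → ScaledDegLe m p x → ScaledDegLe m (ΔP K p) x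
    ScaledDegLe-ΔP p hp i lt = coeff-ΔP-from 0 p i (hp i lt)

    ScaledDegLe-tail : ∀ a p {x} → ScaledDegLe m (a ∷ p) (+ m ℤ.+ x) → ScaledDegLe m p x
    ScaledDegLe-tail a p h i x<im = h (suc i) (ℤ.+-monoʳ-< (+ m) x<im)

    ScaledDegLe-*P : ∀ p q {x y} → ScaledDegLe m p x → ScaledDegLe m q y → ScaledDegLe m (p *ₚ q) (x ℤ.+ y)
    ScaledDegLe-*P []      q _  _  i _       = refl
    ScaledDegLe-*P (a ∷ p) q {x} {y} hp hq i x+y<im =
      trans (coeff-*P a p q i) (x≈0∧y≈0⇒x+y≈0 head (tail i x+y<im))
      where
        head : a * coeff K q i ≈ 0#
        head with x ℤ.<? + 0
        ... | yes x<0 = trans (*-congʳ (hp 0 x<0)) (zeroˡ _)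
        ... | no  x≮0 = trans (*-congˡ (hq i (ℤ.≤-<-trans y≤x+y x+y<im))) (zeroʳ a)
          where
            y≤x+y : y ℤ.≤ x ℤ.+ y
            y≤x+y = ℤ.i≤j+i y x {{ℤ.nonNegative (ℤ.≮⇒≥ x≮0)}}
        tail : ∀ i → x ℤ.+ y ℤ.< + (i ℕ.* m) → coeff K (0# ∷ (p *ₚ q)) i ≈ 0#
        tail zero    _  = refl
        tail (suc i) lt = ScaledDegLe-*P p q p-bound hq i
          (≡.subst (ℤ._< _) (≡.sym ([i-k]+j≡[i+j]-k x y (+ m))) (i<k+j⇒i-k<j (+ m) lt))
          where
            p-bound : ScaledDegLe m p (x ℤ.- + m)
            p-bound = ScaledDegLe-tail a p (≡.subst (ScaledDegLe m (a ∷ p)) (≡.sym (k+[i-k]≡i (+ m) x)) hp)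
            [i-k]+j≡[i+j]-k : ∀ i j k → (i ℤ.- k) ℤ.+ j ≡ (i ℤ.+ j) ℤ.- k
            [i-k]+j≡[i+j]-k = solve-∀

  DegEq⇒ScaledDegLe : ∀ {m} p {d} → DegEq K p d → ScaledDegLe m p (+ (d ℕ.* m))
  DegEq⇒ScaledDegLe {m} p {d} (_ , vanish) i (+<+ dm<im) = vanish i (ℕ.*-cancelʳ-< m d i dm<im)

  DegLt⇒ScaledDegLe : ∀ {m} p {d} → DegLt K p (suc d) → ScaledDegLe m p (+ (d ℕ.* m))
  DegLt⇒ScaledDegLe {m} p {d} vanish i (+<+ dm<im) = vanish i (ℕ.*-cancelʳ-< m d i dm<im)

  ScaledDegLe⇒vanishes : ∀ {m} p {d} .{{_ : ℕ.NonZero m}} → ScaledDegLe m p (+ (d ℕ.* m)) →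
                          ∀ i → d < i → coeff K p i ≈ 0#
  ScaledDegLe⇒vanishes {m} p h i d<i = h i (+<+ (ℕ.*-monoˡ-< m d<i))

  DegEq-*P : ∀ p q {α β} → DegEq K p α → DegEq K q β → DegEq K (p *ₚ q) (α ℕ.+ β)
  DegEq-*P p q {α} {β} hp@(p_α≉0 , _) hq@(q_β≉0 , _) =
    (λ top≈0 → x*y≉0 p_α≉0 q_β≉0 (trans (sym (coeff-*P-top p q α β (proj₂ hp) (proj₂ hq))) top≈0)) ,
    ScaledDegLe⇒vanishes {1} (p *ₚ q)
      (≡.subst (ScaledDegLe 1 (p *ₚ q)) (≡.cong +_ (≡.sym (ℕ.*-distribʳ-+ 1 α β)))
        (ScaledDegLe-*P p q (DegEq⇒ScaledDegLe p hp) (DegEq⇒ScaledDegLe q hq)))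

  DegEq-resp-≈P : ∀ p q {d} → p ≈ₚ q → DegEq K p d → DegEq K q d
  DegEq-resp-≈P p q p≈q (p_d≉0 , vanish) =
    (λ q_d≈0 → p_d≉0 (trans (p≈q _) q_d≈0)) , λ i d<i → trans (sym (p≈q i)) (vanish i d<i)

  DegEq-negP : ∀ p {d} → DegEq K p d → DegEq K (-P_ K p) d
  DegEq-negP p {d} (p_d≉0 , vanish) =
    (λ -p_d≈0 → p_d≉0 (-‿injective (trans (sym (coeff-negP p d)) (trans -p_d≈0 (sym -0#≈0#))))) ,
    λ i d<i → trans (coeff-negP p i) (trans (-‿cong (vanish i d<i)) -0#≈0#)

  DegEq-1P : DegEq K (1P K) 0
  DegEq-1P = 1≉0 , λ { (suc i) _ → refl }

  DegEq-+P-dominantˡ : ∀ {m} p q {d x} → DegEq K p d → ScaledDegLe m q x → x ℤ.< + (d ℕ.* m) →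
                       DegEq K (p +ₚ q) d
  DegEq-+P-dominantˡ {m} p q {d} (p_d≉0 , vanish) hq x<dm =
    (λ top≈0 → p_d≉0 (begin
       coeff K p d                ≈⟨ +-identityʳ _ ⟨
       coeff K p d + 0#           ≈⟨ +-congˡ (hq d x<dm) ⟨
       coeff K p d + coeff K q d  ≈⟨ coeff-+P p q d ⟨
       coeff K (p +ₚ q) d         ≈⟨ top≈0 ⟩
       0#                         ∎)) ,
    λ i d<i → trans (coeff-+P p q i) (x≈0∧y≈0⇒x+y≈0 (vanish i d<i)
                                        (hq i (ℤ.<-≤-trans x<dm (ℤ.+≤+ (ℕ.*-monoˡ-≤ m (ℕ.<⇒≤ d<i))))))

  DegEq-+P-dominantʳ : ∀ {m} p q {d x} → DegEq K p d → ScaledDegLe m q x → x ℤ.< + (d ℕ.* m) →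
                       DegEq K (q +ₚ p) d
  DegEq-+P-dominantʳ p q hp hq x<dm =
    DegEq-resp-≈P (p +ₚ q) (q +ₚ p) (+P-comm p q) (DegEq-+P-dominantˡ p q hp hq x<dm)

  zero⊎degree : ∀ p → ¬ ¬ (p ≈ₚ 0P K ⊎ Σ ℕ (DegEq K p))
  zero⊎degree []      k = k (inj₁ (λ _ → refl))
  zero⊎degree (a ∷ p) k = zero⊎degree p λ
    { (inj₂ (d , p_d≉0 , vanish)) → k (inj₂ (suc d , p_d≉0 , λ { (suc i) (s≤s d<i) → vanish i d<i }))
    ; (inj₁ p≈0) → ¬¬-excluded-middle λ
        { (yes a≈0) → k (inj₁ λ { zero → a≈0 ; (suc i) → p≈0 i })
        ; (no  a≉0) → k (inj₂ (0 , a≉0 , λ { (suc i) _ → p≈0 i })) } }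

module Valuation {c ℓ : Level} (K : Field c ℓ) (m : ℕ) where
  open Field K
  open Polynomials K
  open import Algebra.Properties.CommutativeSemigroup ℤ.+-commutativeSemigroup
    using (interchange; xy∙z≈xz∙y; xy∙z≈x∙zy; x∙yz≈xz∙y)

  -- m · deg f ≤ w and m · deg f = w, where deg (a / b) = deg a - deg b
  record ScaledDegLeF (f : Frac K) (w : ℤ) : Set ℓ where
    constructor scaledDegLeF
    field
      den-degree : ℕ
      den-exact  : DegEq K (den f) den-degree
      num-bound  : ScaledDegLe m (num f) (w ℤ.+ + (den-degree ℕ.* m))

  record ScaledDegEqF (f : Frac K) (w : ℤ) : Set ℓ where
    constructor scaledDegEqF
    field
      num-degree den-degree : ℕ
      num-exact : DegEq K (num f) num-degree
      den-exact : DegEq K (den f) den-degree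
      balance   : w ℤ.+ + (den-degree ℕ.* m) ≡ + (num-degree ℕ.* m)

  private
    scale : ℕ → ℤ
    scale d = + (d ℕ.* m)

    scale-+ : ∀ d e → scale (d ℕ.+ e) ≡ scale d ℤ.+ scale e
    scale-+ d e = ≡.cong +_ (ℕ.*-distribʳ-+ m d e)

    [y+b]+d<[x+d]+b : ∀ {x y} b d → y ℤ.< x → (y ℤ.+ b) ℤ.+ d ℤ.< (x ℤ.+ d) ℤ.+ b
    [y+b]+d<[x+d]+b {x} {y} b d y<x = ≡.subst (ℤ._< _) (xy∙z≈xz∙y y d b)
      (ℤ.+-monoˡ-< b (ℤ.+-monoˡ-< d y<x))

  ScaledDegEqF⇒ScaledDegLeF : ∀ {f w} → ScaledDegEqF f w → ScaledDegLeF f w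
  ScaledDegEqF⇒ScaledDegLeF {f} (scaledDegEqF da db ha hb balance) =
    scaledDegLeF db hb (≡.subst (ScaledDegLe m (num f)) (≡.sym balance) (DegEq⇒ScaledDegLe (num f) ha))

  ScaledDegLeF-mono : ∀ {f w w′} → w ℤ.≤ w′ → ScaledDegLeF f w → ScaledDegLeF f w′
  ScaledDegLeF-mono {f} w≤w′ (scaledDegLeF db hb ha) =
    scaledDegLeF db hb (ScaledDegLe-mono (num f) (ℤ.+-monoˡ-≤ (scale db) w≤w′) ha)

  ScaledDegLeF-0F : ∀ w → ScaledDegLeF (0F K) w
  ScaledDegLeF-0F w = scaledDegLeF 0 DegEq-1P (ScaledDegLe-zero (0P K) _ (λ _ → refl))

  ScaledDegLeF-ι : ∀ p {x} → ScaledDegLe m p x → ScaledDegLeF (ι K p) x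
  ScaledDegLeF-ι p {x} hp = scaledDegLeF 0 DegEq-1P (≡.subst (ScaledDegLe m p) (≡.sym (ℤ.+-identityʳ x)) hp)

  ScaledDegEqF-ι : ∀ p {d} → DegEq K p d → ScaledDegEqF (ι K p) (scale d)
  ScaledDegEqF-ι p {d} hp = scaledDegEqF d 0 hp DegEq-1P (ℤ.+-identityʳ (scale d))

  ScaledDegLeF-*F : ∀ {f g u w} → ScaledDegLeF f u → ScaledDegLeF g w → ScaledDegLeF (_*F_ K f g) (u ℤ.+ w)
  ScaledDegLeF-*F {f} {g} {u} {w} (scaledDegLeF db hb ha) (scaledDegLeF dd hd hc) =
    scaledDegLeF (db ℕ.+ dd) (DegEq-*P (den f) (den g) hb hd)
      (≡.subst (ScaledDegLe m (num f *ₚ num g)) bound≡ (ScaledDegLe-*P (num f) (num g) ha hc))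
    where
      bound≡ : (u ℤ.+ scale db) ℤ.+ (w ℤ.+ scale dd) ≡ (u ℤ.+ w) ℤ.+ scale (db ℕ.+ dd)
      bound≡ = ≡.trans (interchange u (scale db) w (scale dd))
                       (≡.cong (ℤ._+_ (u ℤ.+ w)) (≡.sym (scale-+ db dd)))

  ScaledDegEqF-*F : ∀ {f g u w} → ScaledDegEqF f u → ScaledDegEqF g w → ScaledDegEqF (_*F_ K f g) (u ℤ.+ w)
  ScaledDegEqF-*F {f} {g} {u} {w} (scaledDegEqF da db ha hb eq₁) (scaledDegEqF dc dd hc hd eq₂) =
    scaledDegEqF (da ℕ.+ dc) (db ℕ.+ dd) (DegEq-*P (num f) (num g) ha hc) (DegEq-*P (den f) (den g) hb hd) (begin
      (u ℤ.+ w) ℤ.+ scale (db ℕ.+ dd)            ≡⟨ ≡.cong (ℤ._+_ (u ℤ.+ w)) (scale-+ db dd) ⟩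
      (u ℤ.+ w) ℤ.+ (scale db ℤ.+ scale dd)      ≡⟨ interchange u w (scale db) (scale dd) ⟩
      (u ℤ.+ scale db) ℤ.+ (w ℤ.+ scale dd)      ≡⟨ ≡.cong₂ ℤ._+_ eq₁ eq₂ ⟩
      scale da ℤ.+ scale dc                      ≡⟨ scale-+ da dc ⟨
      scale (da ℕ.+ dc)                          ∎)
    where open ≡.≡-Reasoning

  ScaledDegLeF-+F : ∀ {f g w} → ScaledDegLeF f w → ScaledDegLeF g w → ScaledDegLeF (_+F_ K f g) w
  ScaledDegLeF-+F {a / b} {c / d} {w} (scaledDegLeF db hb ha) (scaledDegLeF dd hd hc) =
    scaledDegLeF (db ℕ.+ dd) (DegEq-*P b d hb hd) (ScaledDegLe-+P (a *ₚ d) (c *ₚ b)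
      (≡.subst (ScaledDegLe m (a *ₚ d)) (≡.trans (ℤ.+-assoc w (scale db) (scale dd)) w+scale≡)
        (ScaledDegLe-*P a d ha (DegEq⇒ScaledDegLe d hd)))
      (≡.subst (ScaledDegLe m (c *ₚ b)) (≡.trans (xy∙z≈x∙zy w (scale dd) (scale db)) w+scale≡)
        (ScaledDegLe-*P c b hc (DegEq⇒ScaledDegLe b hb))))
    where
      w+scale≡ : w ℤ.+ (scale db ℤ.+ scale dd) ≡ w ℤ.+ scale (db ℕ.+ dd)
      w+scale≡ = ≡.cong (ℤ._+_ w) (≡.sym (scale-+ db dd))

  ScaledDegEqF-+F-dominantˡ : ∀ {f g x y} → ScaledDegEqF f x → ScaledDegLeF g y → y ℤ.< x →
                              ScaledDegEqF (_+F_ K f g) x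
  ScaledDegEqF-+F-dominantˡ {a / b} {c / d} {x} {y} (scaledDegEqF da db ha hb balance) (scaledDegLeF dd hd hc) y<x =
    scaledDegEqF (da ℕ.+ dd) (db ℕ.+ dd)
      (DegEq-+P-dominantˡ (a *ₚ d) (c *ₚ b) (DegEq-*P a d ha hd) (ScaledDegLe-*P c b hc (DegEq⇒ScaledDegLe b hb))
        (≡.subst (_ ℤ.<_) top≡ ([y+b]+d<[x+d]+b (scale dd) (scale db) y<x)))
      (DegEq-*P b d hb hd)
      (begin
        x ℤ.+ scale (db ℕ.+ dd)           ≡⟨ ≡.cong (ℤ._+_ x) (scale-+ db dd) ⟩
        x ℤ.+ (scale db ℤ.+ scale dd)     ≡⟨ ℤ.+-assoc x (scale db) (scale dd) ⟨
        (x ℤ.+ scale db) ℤ.+ scale dd     ≡⟨ top≡ ⟩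
        scale (da ℕ.+ dd)                 ∎)
    where
      open ≡.≡-Reasoning
      top≡ : (x ℤ.+ scale db) ℤ.+ scale dd ≡ scale (da ℕ.+ dd)
      top≡ = ≡.trans (≡.cong (ℤ._+ scale dd) balance) (≡.sym (scale-+ da dd))

  ScaledDegEqF-+F-dominantʳ : ∀ {f g x y} → ScaledDegLeF f y → ScaledDegEqF g x → y ℤ.< x →
                              ScaledDegEqF (_+F_ K f g) x
  ScaledDegEqF-+F-dominantʳ {a / b} {c / d} {x} {y} (scaledDegLeF db hb ha) (scaledDegEqF dc dd hc hd balance) y<x =
    scaledDegEqF (dc ℕ.+ db) (db ℕ.+ dd)
      (DegEq-+P-dominantʳ (c *ₚ b) (a *ₚ d) (DegEq-*P c b hc hb) (ScaledDegLe-*P a d ha (DegEq⇒ScaledDegLe d hd))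
        (≡.subst (_ ℤ.<_) top≡ ([y+b]+d<[x+d]+b (scale db) (scale dd) y<x)))
      (DegEq-*P b d hb hd)
      (begin
        x ℤ.+ scale (db ℕ.+ dd)           ≡⟨ ≡.cong (ℤ._+_ x) (scale-+ db dd) ⟩
        x ℤ.+ (scale db ℤ.+ scale dd)     ≡⟨ x∙yz≈xz∙y x (scale db) (scale dd) ⟩
        (x ℤ.+ scale dd) ℤ.+ scale db     ≡⟨ top≡ ⟩
        scale (dc ℕ.+ db)                 ∎)
    where
      open ≡.≡-Reasoning
      top≡ : (x ℤ.+ scale dd) ℤ.+ scale db ≡ scale (dc ℕ.+ db)
      top≡ = ≡.trans (≡.cong (ℤ._+ scale db) balance) (≡.sym (scale-+ dc db))

  ScaledDegLeF-ΔF : ∀ {f w} → ScaledDegLeF f w → ScaledDegLeF (ΔF K f) w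
  ScaledDegLeF-ΔF {a / b} {w} (scaledDegLeF db hb ha) =
    scaledDegLeF (db ℕ.+ db) (DegEq-*P b b hb hb)
      (≡.subst (ScaledDegLe m (num (ΔF K (a / b)))) bound≡
        (ScaledDegLe-+P (ΔP K a *ₚ b) (-P_ K (a *ₚ ΔP K b))
          (ScaledDegLe-*P (ΔP K a) b (ScaledDegLe-ΔP a ha) b-bound)
          (ScaledDegLe-negP (a *ₚ ΔP K b) (ScaledDegLe-*P a (ΔP K b) ha (ScaledDegLe-ΔP b b-bound)))))
    where
      b-bound : ScaledDegLe m b (scale db)
      b-bound = DegEq⇒ScaledDegLe b hb
      bound≡ : (w ℤ.+ scale db) ℤ.+ scale db ≡ w ℤ.+ scale (db ℕ.+ db)
      bound≡ = ≡.trans (ℤ.+-assoc w (scale db) (scale db)) (≡.cong (ℤ._+_ w) (≡.sym (scale-+ db db)))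

  ScaledDegEqF-≤-ScaledDegLeF : ∀ {f g w w′} → _≈F_ K f g → ScaledDegLeF f w′ → ScaledDegEqF g w →
                                w ℤ.≤ w′
  ScaledDegEqF-≤-ScaledDegLeF {a / b} {c / d} {w} {w′} f≈g
                              (scaledDegLeF db hb ha) (scaledDegEqF dc dd hc hd balance) =
    ℤ.≮⇒≥ λ w′<w → proj₁ (DegEq-*P c b hc hb) (begin
      coeff K (c *ₚ b) (dc ℕ.+ db)   ≈⟨ f≈g (dc ℕ.+ db) ⟨
      coeff K (a *ₚ d) (dc ℕ.+ db)   ≈⟨ ScaledDegLe-*P a d ha (DegEq⇒ScaledDegLe d hd) (dc ℕ.+ db)
                                          (≡.subst (_ ℤ.<_) top≡ ([y+b]+d<[x+d]+b _ _ w′<w)) ⟩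
      0#                             ∎)
    where
      open SetoidReasoning setoid
      top≡ : (w ℤ.+ scale dd) ℤ.+ scale db ≡ scale (dc ℕ.+ db)
      top≡ = ≡.trans (≡.cong (ℤ._+ scale db) balance) (≡.sym (scale-+ dc db))

  ScaledDegEqF⇒∣ : ∀ {f w} → ScaledDegEqF f w → + m ∣ w
  ScaledDegEqF⇒∣ (scaledDegEqF da db _ _ balance) =
    ∣m+n∣n⇒∣m (≡.subst (+ m ∣_) (≡.sym balance) (m∣scale da)) (m∣scale db)
    where
      m∣scale : ∀ d → + m ∣ scale d
      m∣scale d = divides (+ d) (ℤ.pos-* d m)

  vanishing⊎degree : ∀ f → NonzeroDen K f → ¬ ¬ ((∀ w → ScaledDegLeF f w) ⊎ Σ ℤ (ScaledDegEqF f))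
  vanishing⊎degree (a / b) b≉0 k = zero⊎degree b λ
    { (inj₁ b≈0) → b≉0 b≈0
    ; (inj₂ (db , hb)) → zero⊎degree a λ
        { (inj₁ a≈0) → k (inj₁ λ w → scaledDegLeF db hb (ScaledDegLe-zero a _ a≈0))
        ; (inj₂ (da , ha)) →
            k (inj₂ (scale da ℤ.- scale db , scaledDegEqF da db ha hb ([i-j]+j≡i (scale da) (scale db)))) } }
    where
      [i-j]+j≡i : ∀ i j → (i ℤ.- j) ℤ.+ j ≡ i
      [i-j]+j≡i = solve-∀

module OperatorWeight {c ℓ : Level} (K : Field c ℓ) (m : ℕ) where
  open Field K using (sym)
  open Valuation K m

  -- The term f Δʲ has weight m · deg f + j; WeightLe A u: every term of A weighs at most u.
  data WeightLe : Op K → ℤ → Set (c ⊔ ℓ) where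
    []  : ∀ {u} → WeightLe [] u
    _∷_ : ∀ {f A u} → ScaledDegLeF f u → WeightLe A (ℤ.pred u) → WeightLe (f ∷ A) u

  data TopAt : Op K → ℕ → ℤ → Set (c ⊔ ℓ) where
    here  : ∀ {f A u} → ScaledDegEqF f u → WeightLe A (ℤ.pred (ℤ.pred u)) → TopAt (f ∷ A) zero u
    there : ∀ {f A n u} → ScaledDegLeF f (ℤ.pred u) → TopAt A n (ℤ.pred u) → TopAt (f ∷ A) (suc n) u

  data ExactAt : Op K → ℕ → ℤ → Set (c ⊔ ℓ) where
    here  : ∀ {f A u} → ScaledDegEqF f u → ExactAt (f ∷ A) zero u
    there : ∀ {f A n u} → ExactAt A n (ℤ.pred u) → ExactAt (f ∷ A) (suc n) u

  Vanishes : Op K → Set (c ⊔ ℓ)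
  Vanishes A = ∀ u → WeightLe A u

  HasTop : Op K → Set (c ⊔ ℓ)
  HasTop A = Σ ℕ λ n → Σ ℤ (TopAt A n)

  private
    pred[i]<i : ∀ i → ℤ.pred i ℤ.< i
    pred[i]<i i = ℤ.i≤pred[j]⇒i<j ℤ.≤-refl

    pred[i]≤i : ∀ i → ℤ.pred i ℤ.≤ i
    pred[i]≤i i = ℤ.<⇒≤ (pred[i]<i i)

    pred-cancel-≤ : ∀ {i j} → ℤ.pred i ℤ.≤ ℤ.pred j → i ℤ.≤ j
    pred-cancel-≤ {i} {j} h = ≡.subst₂ ℤ._≤_ (ℤ.suc-pred i) (ℤ.suc-pred j) (ℤ.suc-mono h)

    pred-suc-shift : ∀ i j → ℤ.pred i ℤ.+ ℤ.suc j ≡ i ℤ.+ j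
    pred-suc-shift = shift
      where
        shift : ∀ i j → (ℤ.-1ℤ ℤ.+ i) ℤ.+ (ℤ.1ℤ ℤ.+ j) ≡ i ℤ.+ j
        shift = solve-∀

    ≈F-sym : ∀ f g → _≈F_ K f g → _≈F_ K g f
    ≈F-sym f g f≈g i = sym (f≈g i)

  WeightLe-mono : ∀ {A u u′} → u ℤ.≤ u′ → WeightLe A u → WeightLe A u′
  WeightLe-mono u≤u′ []        = []
  WeightLe-mono u≤u′ (hf ∷ hA) = ScaledDegLeF-mono u≤u′ hf ∷ WeightLe-mono (ℤ.pred-mono u≤u′) hA

  TopAt⇒WeightLe : ∀ {A n u} → TopAt A n u → WeightLe A u
  TopAt⇒WeightLe (here  hf hA) = ScaledDegEqF⇒ScaledDegLeF hf ∷ WeightLe-mono (pred[i]≤i _) hA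
  TopAt⇒WeightLe (there hf t)  = ScaledDegLeF-mono (pred[i]≤i _) hf ∷ TopAt⇒WeightLe t

  TopAt⇒ExactAt : ∀ {A n u} → TopAt A n u → ExactAt A n u
  TopAt⇒ExactAt (here  hf _) = here hf
  TopAt⇒ExactAt (there _ t)  = there (TopAt⇒ExactAt t)

  TopAt⇒<length : ∀ {A n u} → TopAt A n u → n < length A
  TopAt⇒<length (here  _ _) = s≤s z≤n
  TopAt⇒<length (there _ t) = s≤s (TopAt⇒<length t)

  WeightLe-+O : ∀ {A B u} → WeightLe A u → WeightLe B u → WeightLe (_+O_ K A B) u
  WeightLe-+O []        hB        = hB
  WeightLe-+O (hf ∷ hA) []        = hf ∷ hA
  WeightLe-+O (hf ∷ hA) (hg ∷ hB) = ScaledDegLeF-+F hf hg ∷ WeightLe-+O hA hB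

  TopAt-+Oˡ : ∀ {A B n u} → TopAt A n u → WeightLe B (ℤ.pred u) → TopAt (_+O_ K A B) n u
  TopAt-+Oˡ (here hf hA)         []        = here hf hA
  TopAt-+Oˡ (there hf t)         []        = there hf t
  TopAt-+Oˡ (here {u = u} hf hA) (hg ∷ hB) =
    here (ScaledDegEqF-+F-dominantˡ hf hg (pred[i]<i u)) (WeightLe-+O hA hB)
  TopAt-+Oˡ (there hf t)         (hg ∷ hB) = there (ScaledDegLeF-+F hf hg) (TopAt-+Oˡ t hB)

  TopAt-+Oʳ : ∀ {A B n u} → WeightLe A (ℤ.pred u) → TopAt B n u → TopAt (_+O_ K A B) n u
  TopAt-+Oʳ []        t                      = t
  TopAt-+Oʳ (hf ∷ hA) (here {u = u} hg hB)   =
    here (ScaledDegEqF-+F-dominantʳ hf hg (pred[i]<i u)) (WeightLe-+O hA hB)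
  TopAt-+Oʳ (hf ∷ hA) (there hg t)           = there (ScaledDegLeF-+F hf hg) (TopAt-+Oʳ hA t)

  WeightLe-scaleO : ∀ {a x B u} → ScaledDegLeF a x → WeightLe B u → WeightLe (scaleO K a B) (x ℤ.+ u)
  WeightLe-scaleO ha []                  = []
  WeightLe-scaleO {x = x} ha (_∷_ {u = u} hf hB) =
    ScaledDegLeF-*F ha hf ∷ ≡.subst (WeightLe _) (ℤ.+-pred x u) (WeightLe-scaleO ha hB)

  TopAt-scaleO : ∀ {a x B n u} → ScaledDegEqF a x → TopAt B n u → TopAt (scaleO K a B) n (x ℤ.+ u)
  TopAt-scaleO {x = x} ha (here {u = u} hf hB) =
    here (ScaledDegEqF-*F ha hf)
      (≡.subst (WeightLe _) (≡.trans (ℤ.+-pred x (ℤ.pred u)) (≡.cong ℤ.pred (ℤ.+-pred x u)))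
        (WeightLe-scaleO (ScaledDegEqF⇒ScaledDegLeF ha) hB))
  TopAt-scaleO {x = x} ha (there {u = u} hf t) =
    there (≡.subst (ScaledDegLeF _) (ℤ.+-pred x u) (ScaledDegLeF-*F (ScaledDegEqF⇒ScaledDegLeF ha) hf))
          (≡.subst (TopAt _ _) (ℤ.+-pred x u) (TopAt-scaleO ha t))

  WeightLe-map-ΔF : ∀ {B u} → WeightLe B u → WeightLe (map (ΔF K) B) u
  WeightLe-map-ΔF []        = []
  WeightLe-map-ΔF (hf ∷ hB) = ScaledDegLeF-ΔF hf ∷ WeightLe-map-ΔF hB

  WeightLe-ΔO : ∀ {B u} → WeightLe B u → WeightLe (ΔO K B) (ℤ.suc u)
  WeightLe-ΔO {u = u} hB =
    WeightLe-+O (WeightLe-mono (ℤ.i≤j+i u ℤ.1ℤ) (WeightLe-map-ΔF hB))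
                (ScaledDegLeF-0F _ ∷ ≡.subst (WeightLe _) (≡.sym (ℤ.pred-suc u)) hB)

  TopAt-ΔO : ∀ {B n u} → TopAt B n u → TopAt (ΔO K B) (suc n) (ℤ.suc u)
  TopAt-ΔO {u = u} t =
    TopAt-+Oʳ (≡.subst (WeightLe _) (≡.sym (ℤ.pred-suc u)) (WeightLe-map-ΔF (TopAt⇒WeightLe t)))
              (there (ScaledDegLeF-0F _) (≡.subst (TopAt _ _) (≡.sym (ℤ.pred-suc u)) t))

  WeightLe-*O : ∀ {A B u w} → WeightLe A u → WeightLe B w → WeightLe (_*O_ K A B) (u ℤ.+ w)
  WeightLe-*O []                         hB = []
  WeightLe-*O {w = w} (_∷_ {u = u} ha hA) hB =
    WeightLe-+O (WeightLe-scaleO ha hB)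
                (≡.subst (WeightLe _) (pred-suc-shift u w) (WeightLe-*O hA (WeightLe-ΔO hB)))

  TopAt-*O : ∀ {A B i j u w} → TopAt A i u → TopAt B j w → TopAt (_*O_ K A B) (i ℕ.+ j) (u ℤ.+ w)
  TopAt-*O {w = w} (here {u = u} ha hA) tB =
    TopAt-+Oˡ (TopAt-scaleO ha tB)
      (≡.subst (WeightLe _) (≡.trans (ℤ.pred-+ (ℤ.pred u) (ℤ.suc w)) (≡.cong ℤ.pred (pred-suc-shift u w)))
        (WeightLe-*O hA (WeightLe-ΔO (TopAt⇒WeightLe tB))))
  TopAt-*O {i = suc i} {j} {w = w} (there {u = u} ha tA) tB =
    TopAt-+Oʳ (≡.subst (WeightLe _) (ℤ.pred-+ u w) (WeightLe-scaleO ha (TopAt⇒WeightLe tB)))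
              (≡.subst₂ (TopAt _) (ℕ.+-suc i j) (pred-suc-shift u w) (TopAt-*O tA (TopAt-ΔO tB)))

  TopAt-≤-WeightLe : ∀ {A B n u w} → _≈O_ K A B → TopAt A n u → WeightLe B w → u ℤ.≤ w
  TopAt-≤-WeightLe {w = w} A≈B (here {f} hf _) [] =
    ScaledDegEqF-≤-ScaledDegLeF (≈F-sym f (0F K) (A≈B 0)) (ScaledDegLeF-0F w) hf
  TopAt-≤-WeightLe A≈B (here {f} hf _) (_∷_ {g} hg _) =
    ScaledDegEqF-≤-ScaledDegLeF (≈F-sym f g (A≈B 0)) hg hf
  TopAt-≤-WeightLe A≈B (there _ t) []       = pred-cancel-≤ (TopAt-≤-WeightLe (λ i → A≈B (suc i)) t [])
  TopAt-≤-WeightLe A≈B (there _ t) (_ ∷ hB) = pred-cancel-≤ (TopAt-≤-WeightLe (λ i → A≈B (suc i)) t hB)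

  ExactAt-≤-WeightLe : ∀ {A B k v w} → _≈O_ K A B → WeightLe A v → ExactAt B k w → w ℤ.≤ v
  ExactAt-≤-WeightLe {v = v} A≈B [] (here hg) = ScaledDegEqF-≤-ScaledDegLeF (A≈B 0) (ScaledDegLeF-0F v) hg
  ExactAt-≤-WeightLe A≈B (hf ∷ _)   (here hg) = ScaledDegEqF-≤-ScaledDegLeF (A≈B 0) hf hg
  ExactAt-≤-WeightLe A≈B []         (there e) = pred-cancel-≤ (ExactAt-≤-WeightLe (λ i → A≈B (suc i)) [] e)
  ExactAt-≤-WeightLe A≈B (_ ∷ hA)   (there e) = pred-cancel-≤ (ExactAt-≤-WeightLe (λ i → A≈B (suc i)) hA e)

  ExactAt-below-TopAt : ∀ {A B n k u w} → _≈O_ K A B → TopAt A n u → ExactAt B k w → k ≢ n →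
                        w ℤ.≤ ℤ.pred u
  ExactAt-below-TopAt A≈B (here _ _)   (here _)  k≢n = ⊥-elim (k≢n ≡.refl)
  ExactAt-below-TopAt A≈B (here _ hA)  (there e) _   =
    pred-cancel-≤ (ExactAt-≤-WeightLe (λ i → A≈B (suc i)) hA e)
  ExactAt-below-TopAt A≈B (there hf _) (here hg) _   = ScaledDegEqF-≤-ScaledDegLeF (A≈B 0) hf hg
  ExactAt-below-TopAt A≈B (there _ t)  (there e) k≢n =
    pred-cancel-≤ (ExactAt-below-TopAt (λ i → A≈B (suc i)) t e (λ k≡n → k≢n (≡.cong suc k≡n)))

  ExactAt⇒∣ : ∀ {A n u} → ExactAt A n u → + m ∣ u ℤ.- + n
  ExactAt⇒∣ {u = u} (here hf) = ≡.subst (+ m ∣_) (≡.sym (ℤ.+-identityʳ u)) (ScaledDegEqF⇒∣ hf)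
  ExactAt⇒∣ {n = suc n} {u} (there e) =
    ≡.subst (+ m ∣_) (≡.trans (ℤ.pred-+ u (ℤ.- + n)) (≡.sym (ℤ.minus-suc u n))) (ExactAt⇒∣ e)

  -- Terms of index < m have pairwise distinct weights, since m · deg f is divisible by m.
  vanishes⊎HasTop : ∀ A → WellFormed K A → length A ≤ m → ¬ ¬ (Vanishes A ⊎ HasTop A)
  vanishes⊎HasTop []      _             _   k = k (inj₁ λ _ → [])
  vanishes⊎HasTop (f ∷ A) (f-ok , A-ok) len k =
    vanishing⊎degree f f-ok λ f-shape →
    vanishes⊎HasTop A A-ok (ℕ.≤-trans (ℕ.n≤1+n _) len) λ A-shape →
    k (cons f-shape A-shape)
    where
      cons : (∀ w → ScaledDegLeF f w) ⊎ Σ ℤ (ScaledDegEqF f) → Vanishes A ⊎ HasTop A →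
             Vanishes (f ∷ A) ⊎ HasTop (f ∷ A)
      cons (inj₁ f≤) (inj₁ A≤)           = inj₁ λ u → f≤ u ∷ A≤ (ℤ.pred u)
      cons (inj₁ f≤) (inj₂ (n , u , t))  =
        inj₂ (suc n , ℤ.suc u , there (f≤ _) (≡.subst (TopAt A n) (≡.sym (ℤ.pred-suc u)) t))
      cons (inj₂ (x , f≡)) (inj₁ A≤)     = inj₂ (0 , x , here f≡ (A≤ _))
      cons (inj₂ (x , f≡)) (inj₂ (n , u , t)) with ℤ.<-cmp x (ℤ.suc u)
      ... | tri< x<u+1 _ _ = inj₂ (suc n , ℤ.suc u ,
              there (ScaledDegLeF-mono (ℤ.i<j⇒i≤pred[j] x<u+1) (ScaledDegEqF⇒ScaledDegLeF f≡))
                    (≡.subst (TopAt A n) (≡.sym (ℤ.pred-suc u)) t))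
      ... | tri> _ _ u+1<x = inj₂ (0 , x , here f≡ (WeightLe-mono u≤x-2 (TopAt⇒WeightLe t)))
        where
          u≤x-2 : u ℤ.≤ ℤ.pred (ℤ.pred x)
          u≤x-2 = ≡.subst (ℤ._≤ _) (ℤ.pred-suc u) (ℤ.pred-mono (ℤ.i<j⇒i≤pred[j] u+1<x))
      ... | tri≈ _ x≡u+1 _ = ⊥-elim (ℕ.>⇒∤ n+1<m (∣⇒∣ᵤ (≡.subst (+ m ∣_) difference m∣difference)))
        where
          n+1<m : suc n < m
          n+1<m = ℕ.<-≤-trans (s≤s (TopAt⇒<length t)) len
          m∣difference : + m ∣ x ℤ.- (u ℤ.- + n)
          m∣difference = ∣m∣n⇒∣m-n (ScaledDegEqF⇒∣ f≡) (ExactAt⇒∣ (TopAt⇒ExactAt t))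
          difference : x ℤ.- (u ℤ.- + n) ≡ + suc n
          difference = ≡.subst (λ x → x ℤ.- (u ℤ.- + n) ≡ + suc n) (≡.sym x≡u+1)
                                ([1+u]-[u-n]≡1+n u (+ n))
            where
              [1+u]-[u-n]≡1+n : ∀ u n → (ℤ.1ℤ ℤ.+ u) ℤ.- (u ℤ.- n) ≡ ℤ.1ℤ ℤ.+ n
              [1+u]-[u-n]≡1+n = solve-∀

  WeightLe-exists : ∀ {A} → Vanishes A ⊎ HasTop A → Σ ℤ (WeightLe A)
  WeightLe-exists (inj₁ A≤)          = ℤ.0ℤ , A≤ ℤ.0ℤ
  WeightLe-exists (inj₂ (_ , u , t)) = u , TopAt⇒WeightLe t

  Vanishes-*Oˡ : ∀ {A B w} → Vanishes A → WeightLe B w → Vanishes (_*O_ K A B)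
  Vanishes-*Oˡ {w = w} A≤ hB v = ≡.subst (WeightLe _) ([i-k]+k≡i v w) (WeightLe-*O (A≤ (v ℤ.- w)) hB)
    where
      [i-k]+k≡i : ∀ i k → (i ℤ.- k) ℤ.+ k ≡ i
      [i-k]+k≡i = solve-∀

  Vanishes-*Oʳ : ∀ {A B u} → WeightLe A u → Vanishes B → Vanishes (_*O_ K A B)
  Vanishes-*Oʳ {u = u} hA B≤ v = ≡.subst (WeightLe _) (k+[i-k]≡i u v) (WeightLe-*O hA (B≤ (v ℤ.- u)))

  ¬Vanishes-≈O-ExactAt : ∀ {A B k w} → _≈O_ K A B → Vanishes A → ¬ ExactAt B k w
  ¬Vanishes-≈O-ExactAt {w = w} A≈B A≤ e =
    ℤ.<⇒≱ (pred[i]<i w) (ExactAt-≤-WeightLe A≈B (A≤ (ℤ.pred w)) e)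

  ¬TopAt-≈O-tie : ∀ {A B n u w k₁ k₂} → _≈O_ K A B → TopAt A n u →
                  WeightLe B w → ExactAt B k₁ w → ExactAt B k₂ w → k₁ ≢ k₂ → ⊥
  ¬TopAt-≈O-tie {n = n} {u} {w} {k₁} A≈B t hB e₁ e₂ k₁≢k₂ =
    ℤ.<⇒≱ (pred[i]<i u) (ℤ.≤-trans (TopAt-≤-WeightLe A≈B t hB) w≤u-1)
    where
      w≤u-1 : w ℤ.≤ ℤ.pred u
      w≤u-1 with k₁ ℕ.≟ n
      ... | yes ≡.refl = ExactAt-below-TopAt A≈B t e₂ (λ k₂≡k₁ → k₁≢k₂ (≡.sym k₂≡k₁))
      ... | no  k₁≢n   = ExactAt-below-TopAt A≈B t e₁ k₁≢n

module OperatorE {c ℓ : Level} (K : Field c ℓ) (m′ S : ℕ) (N : Poly K) (P : ℕ → Poly K)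
  (N-deg : DegEq K N S) (Pm-deg : DegEq K (P (suc m′)) (suc S))
  (P-deg : ∀ j → 1 ≤ j → j < suc m′ → DegLt K (P j) (suc S)) where
  open Polynomials K
  open Valuation K (suc m′)
  open OperatorWeight K (suc m′)

  private
    E : Op K
    E = opE K (suc m′) N P

    top : ℤ
    top = + (suc S ℕ.* suc m′)

    shift-suc : ∀ j → + (S ℕ.* suc m′ ℕ.+ j) ≡ ℤ.pred (+ (S ℕ.* suc m′ ℕ.+ suc j))
    shift-suc j = ≡.cong (ℤ.pred ∘ +_) (≡.sym (ℕ.+-suc _ j))

    pred-top : + (S ℕ.* suc m′ ℕ.+ m′) ≡ ℤ.pred top
    pred-top = ≡.cong +_ (ℕ.+-comm _ m′)

    head-exact : ScaledDegEqF (ι K (-P_ K (P (suc m′)))) top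
    head-exact = ScaledDegEqF-ι (-P_ K (P (suc m′))) (DegEq-negP (P (suc m′)) Pm-deg)

  WeightLe-opE-from : ∀ j → j < suc m′ → WeightLe (opE-from K j P N) (+ (S ℕ.* suc m′ ℕ.+ j))
  WeightLe-opE-from zero    _     =
    ScaledDegLeF-mono (ℤ.+≤+ (ℕ.m≤m+n _ 0)) (ScaledDegEqF⇒ScaledDegLeF (ScaledDegEqF-ι N N-deg)) ∷ []
  WeightLe-opE-from (suc j) j<m =
    ScaledDegLeF-ι (-P_ K (P (suc j))) (ScaledDegLe-negP (P (suc j))
      (ScaledDegLe-mono (P (suc j)) (ℤ.+≤+ (ℕ.m≤m+n _ _))
        (DegLt⇒ScaledDegLe (P (suc j)) (P-deg (suc j) (s≤s z≤n) j<m))))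
    ∷ ≡.subst (WeightLe _) (shift-suc j) (WeightLe-opE-from j (ℕ.<-trans (ℕ.n<1+n j) j<m))

  ExactAt-opE-from : ∀ j → ExactAt (opE-from K j P N) j (+ (S ℕ.* suc m′ ℕ.+ j))
  ExactAt-opE-from zero    =
    here (≡.subst (ScaledDegEqF _) (≡.cong +_ (≡.sym (ℕ.+-identityʳ _))) (ScaledDegEqF-ι N N-deg))
  ExactAt-opE-from (suc j) = there (≡.subst (ExactAt _ j) (shift-suc j) (ExactAt-opE-from j))

  E-head : ExactAt E 0 top
  E-head = here head-exact

  E-last : ExactAt E (suc m′) top
  E-last = there (≡.subst (ExactAt _ m′) pred-top (ExactAt-opE-from m′))

  E-weight : WeightLe E top
  E-weight = ScaledDegEqF⇒ScaledDegLeF head-exact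
           ∷ ≡.subst (WeightLe _) pred-top (WeightLe-opE-from m′ (ℕ.n<1+n m′))

  opE-irreducible : Irreducible K (suc m′) E
  opE-irreducible (A , B , A-ok , B-ok , A-len , B-len , AB≈E) =
    vanishes⊎HasTop A A-ok A-len λ A-shape →
    vanishes⊎HasTop B B-ok B-len λ B-shape →
    ¬product A-shape B-shape
    where
      ¬product : Vanishes A ⊎ HasTop A → Vanishes B ⊎ HasTop B → ⊥
      ¬product (inj₂ (_ , _ , tA)) (inj₂ (_ , _ , tB)) =
        ¬TopAt-≈O-tie AB≈E (TopAt-*O tA tB) E-weight E-head E-last (λ ())
      ¬product (inj₁ A≤) B-shape =
        ¬Vanishes-≈O-ExactAt AB≈E (Vanishes-*Oˡ A≤ (proj₂ (WeightLe-exists B-shape))) E-head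
      ¬product A-shape (inj₁ B≤) =
        ¬Vanishes-≈O-ExactAt AB≈E (Vanishes-*Oʳ (proj₂ (WeightLe-exists A-shape)) B≤) E-head

corollary4p1 : {c ℓ : Level} (K : Field c ℓ) → CharZero K →
    (m : ℕ) → 2 ≤ m →
    (N : Poly K) → (P : ℕ → Poly K) → (S : ℕ) →
    DegEq K N S →
    DegEq K (P m) (suc S) →
    (∀ j → 1 ≤ j → j < m → DegLt K (P j) (suc S)) →
    Irreducible K m (opE K m N P)
corollary4p1 K _ (suc m′) (s≤s _) N P S N-deg Pm-deg P-deg =
  OperatorE.opE-irreducible K m′ S N P N-deg Pm-deg P-deg
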